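{- For $\theta>0$ and integers $N\ge1$, let $W(N,k)=\sum_{k\text{ -winnable }\pi\in\mathfrak{S}_N}\theta^{\mathrm{lrm}(\pi)}$. Then for all $N$ and $1\le k\le N-1$, $$W(N,k)=\theta[\theta]_k\frac{(N-1)!}{(k-1)!}\sum_{i=k}^{N-1}\frac1i,$$ and $W(N,0)=(N-1)!\,\theta$.
   Context: $\mathrm{lrm}(\pi)$ is the number of left-to-right maxima of $\pi$ (entries larger than all entries to their left). $[\theta]_k=\theta(\theta+1)\cdots(\theta+k-1)$. A permutation $\pi\in\mathfrak{S}_N$ is $k$-winnable if the strategy that rejects the first $k$ entries and then accepts the first subsequent left-to-right maximum selects the entry $N$.
   Formalization: The parameter θ ranges over the positive rationals instead of the positive reals. -}

module Defs where

open import Data.Nat as ℕ using (ℕ; zero; suc; _∸_; _!; _<ᵇ_)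
open import Data.Nat.Properties using (_!≢0)
open import Data.Bool using (Bool; true; false; if_then_else_)
open import Data.Fin as Fin using (Fin; toℕ)
open import Data.Fin.Properties using () renaming (_≟_ to _≟ᶠ_)
open import Data.Integer using (+_)
open import Data.List using (List; []; _∷_; map; concatMap; filter; allFin; upTo; foldr)
open import Data.List.Relation.Unary.Unique.Propositional using (Unique)
open import Data.Maybe using (Maybe; just; nothing)
open import Data.Rational using (ℚ; 0ℚ; 1ℚ; _+_; _*_; _/_)
import Data.List.Relation.Unary.Unique.DecPropositional as UD

-- Permutations of [N] as one-line words π(1) … π(N).
-- Entries are elements of Fin N; the value `toℕ x` stands for the entry
-- `toℕ x + 1`, so the largest entry N is the one with toℕ x ≡ N ∸ 1.

words : (n l : ℕ) → List (List (Fin n))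
words n zero    = [] ∷ []
words n (suc l) = concatMap (λ x → map (x ∷_) (words n l)) (allFin n)

perms : (N : ℕ) → List (List (Fin N))
perms N = filter (UD.unique? _≟ᶠ_) (words N N)

lrmFrom : Maybe ℕ → List ℕ → ℕ
lrmFrom m [] = 0
lrmFrom nothing  (x ∷ xs) = suc (lrmFrom (just x) xs)
lrmFrom (just m) (x ∷ xs) =
  if m <ᵇ x then suc (lrmFrom (just x) xs) else lrmFrom (just m) xs

lrm : List ℕ → ℕ
lrm xs = lrmFrom nothing xs

-- The strategy: reject the first k entries, then accept the first
-- subsequent left-to-right maximum (of the whole word).
-- `select k m xs` : k = number of entries still to be rejected,
-- m = maximum of the entries seen so far.

selectFrom : ℕ → Maybe ℕ → List ℕ → Maybe ℕ
selectFrom k m [] = nothing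
selectFrom zero nothing (x ∷ xs) = just x
selectFrom zero (just m) (x ∷ xs) =
  if m <ᵇ x then just x else selectFrom zero (just m) xs
selectFrom (suc k) nothing (x ∷ xs) = selectFrom k (just x) xs
selectFrom (suc k) (just m) (x ∷ xs) =
  selectFrom k (just (if m <ᵇ x then x else m)) xs

select : ℕ → List ℕ → Maybe ℕ
select k xs = selectFrom k nothing xs

-- π ∈ 𝔖_N is k-winnable iff the strategy selects the entry N
-- (encoded as the value N ∸ 1, see above)
isWinnable : (N k : ℕ) → List (Fin N) → Bool
isWinnable N k π with select k (map toℕ π)
... | nothing = false
... | just v  = v ℕ.≡ᵇ (N ∸ 1)

fromℕ : ℕ → ℚ
fromℕ n = + n / 1

_^_ : ℚ → ℕ → ℚ
θ ^ zero  = 1ℚ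
θ ^ suc n = θ * (θ ^ n)

sumℚ : List ℚ → ℚ
sumℚ = foldr _+_ 0ℚ

rising : ℚ → ℕ → ℚ
rising θ zero    = 1ℚ
rising θ (suc k) = rising θ k * (θ + fromℕ k)

-- 1 / i  (only used for i ≥ 1)
recip : ℕ → ℚ
recip zero    = 0ℚ
recip (suc i) = + 1 / suc i

harmonic : (k N : ℕ) → ℚ
harmonic k N = sumℚ (map (λ j → recip (k ℕ.+ j)) (upTo (N ∸ k)))

factRatio : (N k : ℕ) → ℚ
factRatio N k = (+ ((N ∸ 1) !) / ((k ∸ 1) !)) {{(k ∸ 1) !≢0}}

W : ℚ → (N k : ℕ) → ℚ
W θ N k = sumℚ (map (λ π → if isWinnable N k π then θ ^ lrm (map toℕ π) else 0ℚ)
                    (perms N))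

-- Deleting the smallest entry of a permutation of [N+1] and standardising the rest
-- is a bijection onto 𝔖_N × {0,…,N} (the permutation and the position of the deleted entry).
-- Inserting the new minimum in front adds a left-to-right maximum and takes up one of the
-- rejected places; inserting it further right changes neither the left-to-right maxima nor
-- the selected entry, and takes up a rejected place exactly when it lands among the first k.
-- Hence W(N+1,k+1) = (θ+k) W(N,k) + (N−k) W(N,k+1) and W(N+1,0) = N W(N,0), a recurrence
-- that the closed form satisfies as well.

module Submission where

open import Defs
open import Data.Bool using (Bool; true; false; if_then_else_)
open import Data.Bool.Properties using (if-float)
open import Data.Empty using (⊥-elim)
open import Data.Fin as Fin using (Fin; toℕ)
import Data.Fin.Properties as FinP
import Data.Integer as ℤ
import Data.Integer.Properties as ℤP
open import Data.List using (List; []; _∷_; map; concatMap; length; _++_; allFin; upTo; applyUpTo;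
  cartesianProduct; cartesianProductWith)
import Data.List.Properties as ListP
open import Data.List.Membership.Propositional using (_∈_; _∉_)
import Data.List.Membership.Propositional.Properties as ∈P
open import Data.List.Membership.Propositional.Properties.WithK using (unique∧set⇒bag)
open import Data.List.Relation.Binary.BagAndSetEquality using (∼bag⇒↭)
open import Data.List.Relation.Binary.Permutation.Propositional using (_↭_; ↭⇒↭ₛ)
import Data.List.Relation.Binary.Permutation.Propositional.Properties as ↭P
import Data.List.Relation.Binary.Permutation.Setoid.Properties as ↭ₛP
open import Data.List.Relation.Unary.All as All using (All; []; _∷_)
import Data.List.Relation.Unary.All.Properties as AllP
open import Data.List.Relation.Unary.AllPairs using ([]; _∷_)
open import Data.List.Relation.Unary.Any using (here; there)
open import Data.List.Relation.Unary.Unique.Propositional using (Unique)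
import Data.List.Relation.Unary.Unique.Propositional.Properties as UniqueP
import Data.List.Relation.Unary.Unique.DecPropositional as UniqueD
open import Data.Maybe as Maybe using (Maybe; just; nothing)
open import Data.Nat as ℕ using (ℕ; zero; suc; _≤_; z≤n; s≤s; _∸_; _!; _<ᵇ_)
import Data.Nat.Properties as ℕP
open import Data.Nat.Properties using (_!≢0)
import Data.Nat.Coprimality as Cop
open import Data.Product using (_×_; _,_; proj₁; proj₂; Σ-syntax)
open import Data.Rational using (ℚ; mkℚ; 0ℚ; 1ℚ; _+_; _*_; _/_; _<_)
import Data.Rational.Properties as ℚP
open import Data.Rational.Solver using (module +-*-Solver)
open import Data.Sum using (inj₁; inj₂)
open import Function using (_∘_)
open import Function.Bundles using (mk⇔)
open import Relation.Binary.PropositionalEquality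

open +-*-Solver

insertAt : {A : Set} → ℕ → A → List A → List A
insertAt zero    v ys       = v ∷ ys
insertAt (suc i) v []       = v ∷ []
insertAt (suc i) v (y ∷ ys) = y ∷ insertAt i v ys

module _ {A : Set} where

  length-insertAt : ∀ i (v : A) ys → length (insertAt i v ys) ≡ suc (length ys)
  length-insertAt zero    v ys       = refl
  length-insertAt (suc i) v []       = refl
  length-insertAt (suc i) v (y ∷ ys) = cong suc (length-insertAt i v ys)

  ∈-insertAt : ∀ i (v : A) ys → v ∈ insertAt i v ys
  ∈-insertAt zero    v ys       = here refl
  ∈-insertAt (suc i) v []       = here refl
  ∈-insertAt (suc i) v (y ∷ ys) = there (∈-insertAt i v ys)

  All-insertAt⁺ : ∀ {P : A → Set} i {v ys} → P v → All P ys → All P (insertAt i v ys)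
  All-insertAt⁺ zero    pv ps       = pv ∷ ps
  All-insertAt⁺ (suc i) pv []       = pv ∷ []
  All-insertAt⁺ (suc i) pv (py ∷ ps) = py ∷ All-insertAt⁺ i pv ps

  All-insertAt⁻ : ∀ {P : A → Set} i {v} ys → All P (insertAt i v ys) → All P ys
  All-insertAt⁻ zero    ys       (_ ∷ ps)  = ps
  All-insertAt⁻ (suc i) []       _         = []
  All-insertAt⁻ (suc i) (y ∷ ys) (py ∷ ps) = py ∷ All-insertAt⁻ i ys ps

  Unique-insertAt⁺ : ∀ i {v : A} {ys} → v ∉ ys → Unique ys → Unique (insertAt i v ys)
  Unique-insertAt⁺ zero    v∉ys u       = AllP.¬Any⇒All¬ _ v∉ys ∷ u
  Unique-insertAt⁺ (suc i) v∉ys []      = [] ∷ []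
  Unique-insertAt⁺ (suc i) v∉ys (y∉ ∷ u) =
    All-insertAt⁺ i (λ y≡v → v∉ys (here (sym y≡v))) y∉ ∷ Unique-insertAt⁺ i (v∉ys ∘ there) u

  Unique-insertAt⁻ : ∀ i {v : A} ys → Unique (insertAt i v ys) → Unique ys
  Unique-insertAt⁻ zero    ys       (_ ∷ u)   = u
  Unique-insertAt⁻ (suc i) []       _         = []
  Unique-insertAt⁻ (suc i) (y ∷ ys) (y∉ ∷ u) = All-insertAt⁻ i ys y∉ ∷ Unique-insertAt⁻ i ys u

  Unique-map⁺-local : {B : Set} {f : A → B} {xs : List A} → Unique xs →
    (∀ {x y} → x ∈ xs → y ∈ xs → f x ≡ f y → x ≡ y) → Unique (map f xs)
  Unique-map⁺-local [] inj = []
  Unique-map⁺-local (x∉ ∷ u) inj =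
    AllP.map⁺ (All.tabulate λ y∈ fx≡fy → All.lookup x∉ y∈ (inj (here refl) (there y∈) fx≡fy))
    ∷ Unique-map⁺-local u (λ x∈ y∈ → inj (there x∈) (there y∈))

IsPermutation : ℕ → List ℕ → Set
IsPermutation N xs = Unique xs × length xs ≡ N × All (ℕ._< N) xs

permsℕ : ℕ → List (List ℕ)
permsℕ N = map (map toℕ) (perms N)

words-suc : ∀ n l → words n (suc l) ≡ cartesianProductWith _∷_ (allFin n) (words n l)
words-suc n l = go (allFin n)
  where
  go : ∀ xs → concatMap (λ x → map (x ∷_) (words n l)) xs
            ≡ cartesianProductWith _∷_ xs (words n l)
  go []       = refl
  go (x ∷ xs) = cong (map (x ∷_) (words n l) ++_) (go xs)

words-unique : ∀ n l → Unique (words n l)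
words-unique n zero    = [] ∷ []
words-unique n (suc l) rewrite words-suc n l =
  UniqueP.cartesianProductWith⁺ _∷_ ListP.∷-injective (UniqueP.allFin⁺ n) (words-unique n l)

∈-words : ∀ n (ws : List (Fin n)) → ws ∈ words n (length ws)
∈-words n []       = here refl
∈-words n (w ∷ ws) rewrite words-suc n (length ws) =
  ∈P.∈-cartesianProductWith⁺ _∷_ (∈P.∈-allFin w) (∈-words n ws)

length-∈-words : ∀ n l {ws} → ws ∈ words n l → length ws ≡ l
length-∈-words n zero    (here refl) = refl
length-∈-words n (suc l) ws∈ rewrite words-suc n l
  with _ , _ , _ , ws∈′ , refl ← ∈P.∈-cartesianProductWith⁻ _∷_ (allFin n) (words n l) ws∈ =
  cong suc (length-∈-words n l ws∈′)

permsℕ-unique : ∀ N → Unique (permsℕ N)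
permsℕ-unique N = UniqueP.map⁺ (ListP.map-injective FinP.toℕ-injective)
  (UniqueP.filter⁺ (UniqueD.unique? FinP._≟_) (words-unique N N))

∈-permsℕ⁻ : ∀ N {xs} → xs ∈ permsℕ N → IsPermutation N xs
∈-permsℕ⁻ N xs∈ with ws , ws∈ , refl ← ∈P.∈-map⁻ (map toℕ) xs∈
  with ws∈words , u ← ∈P.∈-filter⁻ (UniqueD.unique? FinP._≟_) ws∈ =
  UniqueP.map⁺ FinP.toℕ-injective u
  , trans (ListP.length-map toℕ ws) (length-∈-words N N ws∈words)
  , AllP.map⁺ (All.universal FinP.toℕ<n ws)

toFins : ∀ N (xs : List ℕ) → All (ℕ._< N) xs → List (Fin N)
toFins N []       []       = []
toFins N (x ∷ xs) (p ∷ ps) = Fin.fromℕ< p ∷ toFins N xs ps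

map-toℕ-toFins : ∀ N xs ps → map toℕ (toFins N xs ps) ≡ xs
map-toℕ-toFins N []       []       = refl
map-toℕ-toFins N (x ∷ xs) (p ∷ ps) = cong₂ _∷_ (FinP.toℕ-fromℕ< p) (map-toℕ-toFins N xs ps)

∈-permsℕ⁺ : ∀ N {xs} → IsPermutation N xs → xs ∈ permsℕ N
∈-permsℕ⁺ N {xs} (u , len , bounded) = subst (_∈ permsℕ N) xs≡ (∈P.∈-map⁺ (map toℕ)
  (∈P.∈-filter⁺ (UniqueD.unique? FinP._≟_)
    (subst (λ l → ws ∈ words N l) ws-length (∈-words N ws))
    (UniqueP.map⁻ (subst Unique (sym xs≡) u))))
  where
  ws = toFins N xs bounded
  xs≡ = map-toℕ-toFins N xs bounded
  ws-length : length ws ≡ N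
  ws-length = trans (sym (ListP.length-map toℕ ws)) (trans (cong length xs≡) len)

-- Permutations of [N+1] from a new minimum inserted into permutations of [N]

insertMin : List ℕ × ℕ → List ℕ
insertMin (π , i) = insertAt i 0 (map suc π)

0∉map-suc : ∀ π → 0 ∉ map suc π
0∉map-suc (x ∷ π) (there 0∈) = 0∉map-suc π 0∈

All<-map-suc⁻ : ∀ {n} π → All (ℕ._< suc n) (map suc π) → All (ℕ._< n) π
All<-map-suc⁻ []      []             = []
All<-map-suc⁻ (x ∷ π) (s≤s x<n ∷ ps) = x<n ∷ All<-map-suc⁻ π ps

All<-map-suc⁺ : ∀ {n} π → All (ℕ._< n) π → All (ℕ._< suc n) (map suc π)
All<-map-suc⁺ []      []         = []
All<-map-suc⁺ (x ∷ π) (x<n ∷ ps) = s≤s x<n ∷ All<-map-suc⁺ π ps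

length-insertMin : ∀ π i → length (insertMin (π , i)) ≡ suc (length π)
length-insertMin π i = trans (length-insertAt i 0 (map suc π)) (cong suc (ListP.length-map suc π))

insertMin-injective : ∀ {π ρ i j} → i ≤ length π → j ≤ length ρ →
  insertMin (π , i) ≡ insertMin (ρ , j) → (π , i) ≡ (ρ , j)
insertMin-injective {π} {ρ} {zero} {zero} _ _ eq =
  cong (_, 0) (ListP.map-injective ℕP.suc-injective (ListP.∷-injectiveʳ eq))
insertMin-injective {x ∷ π} {y ∷ ρ} {suc i} {suc j} (s≤s i≤) (s≤s j≤) eq
  with refl ← ℕP.suc-injective (ListP.∷-injectiveˡ eq)
  with refl ← insertMin-injective i≤ j≤ (ListP.∷-injectiveʳ eq) = refl
insertMin-injective {ρ = _ ∷ _} {zero} {suc j} _ _ ()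
insertMin-injective {_ ∷ _} {i = suc i} {zero} _ _ ()

data MinView : List ℕ → Set where
  inserted : ∀ π i → i ≤ length π → MinView (insertMin (π , i))
  shifted  : ∀ π → MinView (map suc π)

minView : ∀ {xs} → Unique xs → MinView xs
minView {[]} _ = shifted []
minView {zero ∷ xs} (0∉ ∷ u) with minView u
... | inserted π i _ = ⊥-elim (All.lookup 0∉ (∈-insertAt i 0 (map suc π)) refl)
... | shifted π      = inserted π 0 z≤n
minView {suc x ∷ xs} (_ ∷ u) with minView u
... | inserted π i i≤ = inserted (x ∷ π) (suc i) (s≤s i≤)
... | shifted π       = shifted (x ∷ π)

insertMin⁻ : ∀ {n} π i → Unique (insertMin (π , i)) → All (ℕ._< suc n) (insertMin (π , i)) →
  Unique π × All (ℕ._< n) π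
insertMin⁻ π i u bounded =
  UniqueP.map⁻ (Unique-insertAt⁻ i (map suc π) u) , All<-map-suc⁻ π (All-insertAt⁻ i (map suc π) bounded)

length≤bound : ∀ n {xs} → Unique xs → All (ℕ._< n) xs → length xs ≤ n
length≤bound zero    {[]}    _ _        = z≤n
length≤bound zero    {_ ∷ _} _ (() ∷ _)
length≤bound (suc n) u bounded with minView u
... | inserted π i _
  with uπ , bπ ← insertMin⁻ π i u bounded =
  subst (_≤ suc n) (sym (length-insertMin π i)) (s≤s (length≤bound n uπ bπ))
... | shifted π =
  subst (_≤ suc n) (sym (ListP.length-map suc π))
    (ℕP.m≤n⇒m≤1+n (length≤bound n (UniqueP.map⁻ u) (All<-map-suc⁻ π bounded)))

insertMin-isPermutation : ∀ {N π} i → IsPermutation N π → IsPermutation (suc N) (insertMin (π , i))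
insertMin-isPermutation {N} {π} i (u , len , bounded) =
  Unique-insertAt⁺ i (0∉map-suc π) (UniqueP.map⁺ ℕP.suc-injective u)
  , trans (length-insertMin π i) (cong suc len)
  , All-insertAt⁺ i ℕ.z<s (All<-map-suc⁺ π bounded)

isPermutation-insertMin⁻ : ∀ {N xs} → IsPermutation (suc N) xs →
  Σ[ (π , i) ∈ List ℕ × ℕ ] IsPermutation N π × i ≤ N × xs ≡ insertMin (π , i)
isPermutation-insertMin⁻ {N} (u , len , bounded) with minView u
... | inserted π i i≤
  with uπ , bπ ← insertMin⁻ π i u bounded =
  (π , i) , (uπ , lenπ , bπ) , subst (i ≤_) lenπ i≤ , refl
  where lenπ = ℕP.suc-injective (trans (sym (length-insertMin π i)) len)
... | shifted π = ⊥-elim (ℕP.1+n≰n (subst (_≤ N) (trans (sym (ListP.length-map suc π)) len)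
                    (length≤bound N (UniqueP.map⁻ u) (All<-map-suc⁻ π bounded))))

insertions : ℕ → List (List ℕ)
insertions N = map insertMin (cartesianProduct (permsℕ N) (upTo (suc N)))

insertions-unique : ∀ N → Unique (insertions N)
insertions-unique N = Unique-map⁺-local
  (UniqueP.cartesianProduct⁺ (permsℕ-unique N) (UniqueP.upTo⁺ (suc N))) injective
  where
  bound : ∀ {π i} → (π , i) ∈ cartesianProduct (permsℕ N) (upTo (suc N)) → i ≤ length π
  bound {π} πi∈ with π∈ , i∈ ← ∈P.∈-cartesianProduct⁻ (permsℕ N) (upTo (suc N)) πi∈ =
    subst (_ ≤_) (sym (proj₁ (proj₂ (∈-permsℕ⁻ N π∈)))) (ℕP.≤-pred (∈P.∈-upTo⁻ i∈))
  injective : ∀ {x y} → x ∈ _ → y ∈ _ → insertMin x ≡ insertMin y → x ≡ y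
  injective x∈ y∈ = insertMin-injective (bound x∈) (bound y∈)

∈-insertions⁻ : ∀ N {xs} → xs ∈ insertions N → IsPermutation (suc N) xs
∈-insertions⁻ N xs∈ with (π , i) , πi∈ , refl ← ∈P.∈-map⁻ insertMin xs∈ =
  insertMin-isPermutation i (∈-permsℕ⁻ N (proj₁ (∈P.∈-cartesianProduct⁻ (permsℕ N) _ πi∈)))

∈-insertions⁺ : ∀ N {xs} → IsPermutation (suc N) xs → xs ∈ insertions N
∈-insertions⁺ N p with (π , i) , pπ , i≤N , refl ← isPermutation-insertMin⁻ p =
  ∈P.∈-map⁺ insertMin (∈P.∈-cartesianProduct⁺ (∈-permsℕ⁺ N pπ) (∈P.∈-upTo⁺ (s≤s i≤N)))

permsℕ-suc↭insertions : ∀ N → permsℕ (suc N) ↭ insertions N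
permsℕ-suc↭insertions N = ∼bag⇒↭ (unique∧set⇒bag (permsℕ-unique (suc N)) (insertions-unique N)
  (mk⇔ (∈-insertions⁺ N ∘ ∈-permsℕ⁻ (suc N)) (∈-permsℕ⁺ (suc N) ∘ ∈-insertions⁻ N)))

-- The running maximum after a new smallest entry 0 has been read as well.
sucMax : Maybe ℕ → Maybe ℕ
sucMax nothing  = just 0
sucMax (just m) = just (suc m)

lrmFrom-map-suc : ∀ m xs → lrmFrom (sucMax m) (map suc xs) ≡ lrmFrom m xs
lrmFrom-map-suc m        []       = refl
lrmFrom-map-suc nothing  (x ∷ xs) = cong suc (lrmFrom-map-suc (just x) xs)
lrmFrom-map-suc (just m) (x ∷ xs) with m <ᵇ x
... | true  = cong suc (lrmFrom-map-suc (just x) xs)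
... | false = lrmFrom-map-suc (just m) xs

lrmFrom-insertAt-0 : ∀ m i xs → lrmFrom (just (suc m)) (insertAt i 0 (map suc xs)) ≡ lrmFrom (just m) xs
lrmFrom-insertAt-0 m zero    xs       = lrmFrom-map-suc (just m) xs
lrmFrom-insertAt-0 m (suc i) []       = refl
lrmFrom-insertAt-0 m (suc i) (x ∷ xs) with m <ᵇ x
... | true  = cong suc (lrmFrom-insertAt-0 x i xs)
... | false = lrmFrom-insertAt-0 m i xs

selectFrom-map-suc : ∀ k m xs → selectFrom k (sucMax m) (map suc xs) ≡ Maybe.map suc (selectFrom k m xs)
selectFrom-map-suc k       m        []       = refl
selectFrom-map-suc zero    nothing  (x ∷ xs) = refl
selectFrom-map-suc zero    (just m) (x ∷ xs) with m <ᵇ x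
... | true  = refl
... | false = selectFrom-map-suc zero (just m) xs
selectFrom-map-suc (suc k) nothing  (x ∷ xs) = selectFrom-map-suc k (just x) xs
selectFrom-map-suc (suc k) (just m) (x ∷ xs)
  rewrite sym (if-float suc (m <ᵇ x) {x} {m}) = selectFrom-map-suc k (just (if m <ᵇ x then x else m)) xs

-- When 0 is inserted at position i into a word whose first k entries are rejected,
-- `shrinkThreshold i k` of the rejected entries are original ones: k ∸ 1 if i < k, else k.
shrinkThreshold : ℕ → ℕ → ℕ
shrinkThreshold i       zero    = zero
shrinkThreshold zero    (suc k) = k
shrinkThreshold (suc i) (suc k) = suc (shrinkThreshold i k)

shrinkThreshold-< : ∀ {i k} → i ℕ.< k → suc (shrinkThreshold i k) ≡ k
shrinkThreshold-< {zero}  {suc k} _         = refl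
shrinkThreshold-< {suc i} {suc k} (s≤s i<k) = cong suc (shrinkThreshold-< i<k)

shrinkThreshold-≥ : ∀ {i k} → k ≤ i → shrinkThreshold i k ≡ k
shrinkThreshold-≥ {i}     {zero}  _         = refl
shrinkThreshold-≥ {suc i} {suc k} (s≤s k≤i) = cong suc (shrinkThreshold-≥ k≤i)

selectFrom-insertAt-0 : ∀ k m i xs → selectFrom k (just (suc m)) (insertAt i 0 (map suc xs))
                                     ≡ Maybe.map suc (selectFrom (shrinkThreshold i k) (just m) xs)
selectFrom-insertAt-0 zero    m zero    xs       = selectFrom-map-suc zero (just m) xs
selectFrom-insertAt-0 (suc k) m zero    xs       = selectFrom-map-suc k (just m) xs
selectFrom-insertAt-0 zero    m (suc i) []       = refl
selectFrom-insertAt-0 (suc k) m (suc i) []       = refl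
selectFrom-insertAt-0 zero    m (suc i) (x ∷ xs) with m <ᵇ x
... | true  = refl
... | false = selectFrom-insertAt-0 zero m i xs
selectFrom-insertAt-0 (suc k) m (suc i) (x ∷ xs)
  rewrite sym (if-float suc (m <ᵇ x) {x} {m}) = selectFrom-insertAt-0 k (if m <ᵇ x then x else m) i xs

select-insertMin : ∀ k i π →
  select (suc k) (insertMin (π , i)) ≡ Maybe.map suc (select (shrinkThreshold i (suc k)) π)
select-insertMin k zero    π       = selectFrom-map-suc k nothing π
select-insertMin k (suc i) []      = refl
select-insertMin k (suc i) (x ∷ π) = selectFrom-insertAt-0 k x i π

selectsLast : ℕ → Maybe ℕ → Bool
selectsLast N nothing  = false
selectsLast N (just v) = v ℕ.≡ᵇ (N ∸ 1)

weight : ℚ → ℕ → ℕ → List ℕ → ℚ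
weight θ N k xs = if selectsLast N (select k xs) then θ ^ lrm xs else 0ℚ

W′ : ℚ → ℕ → ℕ → ℚ
W′ θ N k = sumℚ (map (weight θ N k) (permsℕ N))

W≡W′ : ∀ θ N k → W θ N k ≡ W′ θ N k
W≡W′ θ N k = trans (cong sumℚ (ListP.map-cong isWinnable≡ (perms N)))
                   (cong sumℚ (ListP.map-∘ (perms N)))
  where
  isWinnable≡ : ∀ π →
    (if isWinnable N k π then θ ^ lrm (map toℕ π) else 0ℚ) ≡ weight θ N k (map toℕ π)
  isWinnable≡ π with select k (map toℕ π)
  ... | nothing = refl
  ... | just v  = refl

selectsLast-map-suc : ∀ n s → selectsLast (suc (suc n)) (Maybe.map suc s) ≡ selectsLast (suc n) s
selectsLast-map-suc n nothing  = refl
selectsLast-map-suc n (just v) = refl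

weight-insertMin-front : ∀ θ n k π →
  weight θ (suc (suc n)) (suc k) (insertMin (π , 0)) ≡ θ * weight θ (suc n) k π
weight-insertMin-front θ n k π
  rewrite select-insertMin k 0 π | selectsLast-map-suc n (select k π) | lrmFrom-map-suc nothing π
  with selectsLast (suc n) (select k π)
... | true  = refl
... | false = sym (ℚP.*-zeroʳ θ)

weight-insertMin-inner : ∀ θ n k i x π → weight θ (suc (suc n)) (suc k) (insertMin (x ∷ π , suc i))
                                        ≡ weight θ (suc n) (suc (shrinkThreshold i k)) (x ∷ π)
weight-insertMin-inner θ n k i x π
  rewrite select-insertMin k (suc i) (x ∷ π)
        | selectsLast-map-suc n (select (suc (shrinkThreshold i k)) (x ∷ π))
        | lrmFrom-insertAt-0 x i π = refl

weight₀-insertMin-inner : ∀ θ n i x π →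
  weight θ (suc (suc n)) 0 (insertMin (x ∷ π , suc i)) ≡ weight θ (suc n) 0 (x ∷ π)
weight₀-insertMin-inner θ n i x π rewrite lrmFrom-insertAt-0 x i π = refl

fromℕ≡mkℚ : ∀ n → fromℕ n ≡ mkℚ (ℤ.+ n) 0 (Cop.sym (Cop.1-coprimeTo n))
fromℕ≡mkℚ n = ℚP.normalize-coprime (Cop.sym (Cop.1-coprimeTo n))

fromℕ-+ : ∀ m n → fromℕ (m ℕ.+ n) ≡ fromℕ m + fromℕ n
fromℕ-+ m n rewrite fromℕ≡mkℚ m | fromℕ≡mkℚ n = ℚP./-cong {p₁ = ℤ.+ (m ℕ.+ n)} {q₁ = 1}
  (trans (ℤP.pos-+ m n) (sym (cong₂ ℤ._+_ (ℤP.*-identityʳ (ℤ.+ m)) (ℤP.*-identityʳ (ℤ.+ n))))) refl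

fromℕ-* : ∀ m n → fromℕ (m ℕ.* n) ≡ fromℕ m * fromℕ n
fromℕ-* m n rewrite fromℕ≡mkℚ m | fromℕ≡mkℚ n =
  ℚP./-cong {p₁ = ℤ.+ (m ℕ.* n)} {q₁ = 1} (ℤP.pos-* m n) refl

recip≡mkℚ : ∀ n → recip (suc n) ≡ mkℚ (ℤ.+ 1) n (Cop.1-coprimeTo (suc n))
recip≡mkℚ n = ℚP.normalize-coprime (Cop.1-coprimeTo (suc n))

fromℕ*recip : ∀ d .{{_ : ℕ.NonZero d}} → fromℕ d * recip d ≡ 1ℚ
fromℕ*recip (suc n) rewrite fromℕ≡mkℚ (suc n) | recip≡mkℚ n =
  ℚP.*-inverseʳ (mkℚ (ℤ.+ suc n) 0 (Cop.sym (Cop.1-coprimeTo (suc n))))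

/≡fromℕ*recip : ∀ a d .{{_ : ℕ.NonZero d}} → ℤ.+ a / d ≡ fromℕ a * recip d
/≡fromℕ*recip a (suc d) rewrite fromℕ≡mkℚ a | recip≡mkℚ d =
  ℚP./-cong {p₁ = ℤ.+ a} {q₁ = suc d} (sym (ℤP.*-identityʳ (ℤ.+ a))) (sym (ℕP.+-identityʳ (suc d)))

recip-*ˡ : ∀ m d .{{_ : ℕ.NonZero d}} → recip d ≡ fromℕ (suc m) * recip (suc m ℕ.* d)
recip-*ˡ m (suc d) = begin
  r                                  ≡⟨ sym (ℚP.*-identityʳ r) ⟩
  r * 1ℚ                             ≡⟨ cong (r *_) (sym (fromℕ*recip (suc m ℕ.* suc d))) ⟩
  r * (fromℕ (suc m ℕ.* suc d) * r′) ≡⟨ cong (λ z → r * (z * r′)) (fromℕ-* (suc m) (suc d)) ⟩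
  r * (fromℕ (suc m) * fromℕ (suc d) * r′)
    ≡⟨ solve 4 (λ r a b r′ → r :* (a :* b :* r′) := (b :* r) :* (a :* r′))
             refl r (fromℕ (suc m)) (fromℕ (suc d)) r′ ⟩
  (fromℕ (suc d) * r) * (fromℕ (suc m) * r′) ≡⟨ cong (_* (fromℕ (suc m) * r′)) (fromℕ*recip (suc d)) ⟩
  1ℚ * (fromℕ (suc m) * r′)          ≡⟨ ℚP.*-identityˡ _ ⟩
  fromℕ (suc m) * r′                 ∎
  where
  open ≡-Reasoning
  r = recip (suc d)
  r′ = recip (suc m ℕ.* suc d)

sumℚ-↭ : ∀ {xs ys} → xs ↭ ys → sumℚ xs ≡ sumℚ ys
sumℚ-↭ p = ↭ₛP.foldr-commMonoid (setoid ℚ) ℚP.+-0-isCommutativeMonoid (↭⇒↭ₛ p)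

sumℚ-++ : ∀ xs ys → sumℚ (xs ++ ys) ≡ sumℚ xs + sumℚ ys
sumℚ-++ []       ys = sym (ℚP.+-identityˡ (sumℚ ys))
sumℚ-++ (x ∷ xs) ys = trans (cong (x +_) (sumℚ-++ xs ys)) (sym (ℚP.+-assoc x (sumℚ xs) (sumℚ ys)))

sumℚ-map-cartesianProduct : ∀ {A B : Set} (f : A × B → ℚ) xs ys →
  sumℚ (map f (cartesianProduct xs ys)) ≡ sumℚ (map (λ x → sumℚ (map (λ y → f (x , y)) ys)) xs)
sumℚ-map-cartesianProduct f []       ys = refl
sumℚ-map-cartesianProduct f (x ∷ xs) ys = begin
  sumℚ (map f (map (x ,_) ys ++ cartesianProduct xs ys))
    ≡⟨ cong sumℚ (ListP.map-++ f (map (x ,_) ys) _) ⟩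
  sumℚ (map f (map (x ,_) ys) ++ map f (cartesianProduct xs ys))
    ≡⟨ sumℚ-++ (map f (map (x ,_) ys)) _ ⟩
  sumℚ (map f (map (x ,_) ys)) + sumℚ (map f (cartesianProduct xs ys))
    ≡⟨ cong₂ _+_ (cong sumℚ (sym (ListP.map-∘ ys))) (sumℚ-map-cartesianProduct f xs ys) ⟩
  sumℚ (map (λ y → f (x , y)) ys) + sumℚ (map (λ x → sumℚ (map (λ y → f (x , y)) ys)) xs) ∎
  where open ≡-Reasoning

sumℚ-map-linear : ∀ {A : Set} (xs : List A) a b f g →
  sumℚ (map (λ x → a * f x + b * g x) xs) ≡ a * sumℚ (map f xs) + b * sumℚ (map g xs)
sumℚ-map-linear []       a b f g = solve 2 (λ a b → con 0ℚ := a :* con 0ℚ :+ b :* con 0ℚ) refl a b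
sumℚ-map-linear (x ∷ xs) a b f g = trans (cong ((a * f x + b * g x) +_) (sumℚ-map-linear xs a b f g))
  (solve 6 (λ a b fx gx F G → a :* fx :+ b :* gx :+ (a :* F :+ b :* G) := a :* (fx :+ F) :+ b :* (gx :+ G))
         refl a b (f x) (g x) (sumℚ (map f xs)) (sumℚ (map g xs)))

sumℚ-map-*ˡ : ∀ {A : Set} (xs : List A) a f → sumℚ (map (λ x → a * f x) xs) ≡ a * sumℚ (map f xs)
sumℚ-map-*ˡ []       a f = sym (ℚP.*-zeroʳ a)
sumℚ-map-*ˡ (x ∷ xs) a f =
  trans (cong (a * f x +_) (sumℚ-map-*ˡ xs a f)) (sym (ℚP.*-distribˡ-+ a (f x) _))

sumUpTo : ℕ → (ℕ → ℚ) → ℚ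
sumUpTo n h = sumℚ (applyUpTo h n)

sumUpTo-cong : ∀ n {h h′ : ℕ → ℚ} → (∀ i → h i ≡ h′ i) → sumUpTo n h ≡ sumUpTo n h′
sumUpTo-cong zero    eq = refl
sumUpTo-cong (suc n) eq = cong₂ _+_ (eq 0) (sumUpTo-cong n (eq ∘ suc))

sumUpTo-suc : ∀ n h → sumUpTo (suc n) h ≡ sumUpTo n h + h n
sumUpTo-suc zero    h = trans (ℚP.+-identityʳ (h 0)) (sym (ℚP.+-identityˡ (h 0)))
sumUpTo-suc (suc n) h = trans (cong (h 0 +_) (sumUpTo-suc n (h ∘ suc))) (sym (ℚP.+-assoc (h 0) _ _))

sumUpTo-const : ∀ n h c → (∀ i → i ℕ.< n → h i ≡ c) → sumUpTo n h ≡ fromℕ n * c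
sumUpTo-const zero    h c eq = sym (ℚP.*-zeroˡ c)
sumUpTo-const (suc n) h c eq = begin
  h 0 + sumUpTo n (h ∘ suc) ≡⟨ cong₂ _+_ (eq 0 (s≤s z≤n)) (sumUpTo-const n (h ∘ suc) c (λ i → eq (suc i) ∘ s≤s)) ⟩
  c + fromℕ n * c           ≡⟨ solve 2 (λ c n → c :+ n :* c := (con 1ℚ :+ n) :* c) refl c (fromℕ n) ⟩
  (1ℚ + fromℕ n) * c        ≡⟨ cong (_* c) (sym (fromℕ-+ 1 n)) ⟩
  fromℕ (suc n) * c         ∎
  where open ≡-Reasoning

sumUpTo-split : ∀ j n h b c → j ≤ n → (∀ i → i ℕ.< j → h i ≡ b) → (∀ i → j ≤ i → h i ≡ c) →
  sumUpTo n h ≡ fromℕ j * b + fromℕ (n ∸ j) * c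
sumUpTo-split zero n h b c _ _ eq = begin
  sumUpTo n h           ≡⟨ sumUpTo-const n h c (λ i _ → eq i z≤n) ⟩
  fromℕ n * c           ≡⟨ solve 3 (λ b n c → n :* c := con 0ℚ :* b :+ n :* c) refl b (fromℕ n) c ⟩
  0ℚ * b + fromℕ n * c  ∎
  where open ≡-Reasoning
sumUpTo-split (suc j) (suc n) h b c (s≤s j≤n) eq< eq≥ = begin
  h 0 + sumUpTo n (h ∘ suc)
    ≡⟨ cong₂ _+_ (eq< 0 (s≤s z≤n))
                 (sumUpTo-split j n (h ∘ suc) b c j≤n (λ i → eq< (suc i) ∘ s≤s) (λ i → eq≥ (suc i) ∘ s≤s)) ⟩
  b + (fromℕ j * b + fromℕ (n ∸ j) * c)
    ≡⟨ solve 4 (λ b j m c → b :+ (j :* b :+ m :* c) := (con 1ℚ :+ j) :* b :+ m :* c)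
             refl b (fromℕ j) (fromℕ (n ∸ j)) c ⟩
  (1ℚ + fromℕ j) * b + fromℕ (n ∸ j) * c
    ≡⟨ cong (λ z → z * b + fromℕ (n ∸ j) * c) (sym (fromℕ-+ 1 j)) ⟩
  fromℕ (suc j) * b + fromℕ (n ∸ j) * c ∎
  where open ≡-Reasoning

-- The recurrence for W

W′-suc : ∀ θ N k →
  W′ θ (suc N) k
  ≡ sumℚ (map (λ π → sumUpTo (suc N) (λ i → weight θ (suc N) k (insertMin (π , i)))) (permsℕ N))
W′-suc θ N k = begin
  sumℚ (map w (permsℕ (suc N)))
    ≡⟨ sumℚ-↭ (↭P.map⁺ w (permsℕ-suc↭insertions N)) ⟩
  sumℚ (map w (insertions N))
    ≡⟨ cong sumℚ (sym (ListP.map-∘ (cartesianProduct (permsℕ N) (upTo (suc N))))) ⟩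
  sumℚ (map (w ∘ insertMin) (cartesianProduct (permsℕ N) (upTo (suc N))))
    ≡⟨ sumℚ-map-cartesianProduct (w ∘ insertMin) (permsℕ N) (upTo (suc N)) ⟩
  sumℚ (map (λ π → sumℚ (map (λ i → w (insertMin (π , i))) (upTo (suc N)))) (permsℕ N))
    ≡⟨ cong sumℚ (ListP.map-cong (λ π → cong sumℚ (ListP.map-upTo (λ i → w (insertMin (π , i))) (suc N)))
                                 (permsℕ N)) ⟩
  sumℚ (map (λ π → sumUpTo (suc N) (λ i → w (insertMin (π , i)))) (permsℕ N)) ∎
  where
  open ≡-Reasoning
  w = weight θ (suc N) k

insertions-weight-suc : ∀ θ n j π → j ≤ suc n → length π ≡ suc n →
  sumUpTo (suc (suc n)) (λ i → weight θ (suc (suc n)) (suc j) (insertMin (π , i)))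
  ≡ (θ + fromℕ j) * weight θ (suc n) j π + fromℕ (suc n ∸ j) * weight θ (suc n) (suc j) π
insertions-weight-suc θ n j (x ∷ π) j≤ _ = begin
  weight θ (suc (suc n)) (suc j) (insertMin (x ∷ π , 0))
    + sumUpTo (suc n) (λ i → weight θ (suc (suc n)) (suc j) (insertMin (x ∷ π , suc i)))
    ≡⟨ cong₂ _+_ (weight-insertMin-front θ n j (x ∷ π))
         (trans (sumUpTo-cong (suc n) (λ i → weight-insertMin-inner θ n j i x π))
                (sumUpTo-split j (suc n) _ b c j≤
                  (λ i i<j → cong (λ k → weight θ (suc n) k (x ∷ π)) (shrinkThreshold-< i<j))
                  (λ i j≤i → cong (λ k → weight θ (suc n) (suc k) (x ∷ π)) (shrinkThreshold-≥ j≤i)))) ⟩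
  θ * b + (fromℕ j * b + fromℕ (suc n ∸ j) * c)
    ≡⟨ solve 5 (λ θ b j m c → θ :* b :+ (j :* b :+ m :* c) := (θ :+ j) :* b :+ m :* c)
             refl θ b (fromℕ j) (fromℕ (suc n ∸ j)) c ⟩
  (θ + fromℕ j) * b + fromℕ (suc n ∸ j) * c ∎
  where
  open ≡-Reasoning
  b = weight θ (suc n) j (x ∷ π)
  c = weight θ (suc n) (suc j) (x ∷ π)

-- With no rejection the first entry is selected, so inserting 0 in front never wins.
insertions-weight-zero : ∀ θ n π → length π ≡ suc n →
  sumUpTo (suc (suc n)) (λ i → weight θ (suc (suc n)) 0 (insertMin (π , i)))
  ≡ fromℕ (suc n) * weight θ (suc n) 0 π
insertions-weight-zero θ n (x ∷ π) _ =
  trans (ℚP.+-identityˡ _) (sumUpTo-const (suc n) _ _ (λ i _ → weight₀-insertMin-inner θ n i x π))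

W′-recurrence : ∀ θ n j → j ≤ suc n →
  W′ θ (suc (suc n)) (suc j)
  ≡ (θ + fromℕ j) * W′ θ (suc n) j + fromℕ (suc n ∸ j) * W′ θ (suc n) (suc j)
W′-recurrence θ n j j≤ = begin
  W′ θ (suc (suc n)) (suc j)
    ≡⟨ W′-suc θ (suc n) (suc j) ⟩
  sumℚ (map (λ π → sumUpTo (suc (suc n)) (λ i → weight θ (suc (suc n)) (suc j) (insertMin (π , i))))
            (permsℕ (suc n)))
    ≡⟨ cong sumℚ (ListP.map-cong-local (All.tabulate λ {π} π∈ →
         insertions-weight-suc θ n j π j≤ (proj₁ (proj₂ (∈-permsℕ⁻ (suc n) π∈))))) ⟩
  sumℚ (map (λ π → (θ + fromℕ j) * weight θ (suc n) j π + fromℕ (suc n ∸ j) * weight θ (suc n) (suc j) π)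
            (permsℕ (suc n)))
    ≡⟨ sumℚ-map-linear (permsℕ (suc n)) (θ + fromℕ j) (fromℕ (suc n ∸ j)) _ _ ⟩
  (θ + fromℕ j) * W′ θ (suc n) j + fromℕ (suc n ∸ j) * W′ θ (suc n) (suc j) ∎
  where open ≡-Reasoning

W′-recurrence₀ : ∀ θ n → W′ θ (suc (suc n)) 0 ≡ fromℕ (suc n) * W′ θ (suc n) 0
W′-recurrence₀ θ n = begin
  W′ θ (suc (suc n)) 0
    ≡⟨ W′-suc θ (suc n) 0 ⟩
  sumℚ (map (λ π → sumUpTo (suc (suc n)) (λ i → weight θ (suc (suc n)) 0 (insertMin (π , i))))
            (permsℕ (suc n)))
    ≡⟨ cong sumℚ (ListP.map-cong-local (All.tabulate λ {π} π∈ →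
         insertions-weight-zero θ n π (proj₁ (proj₂ (∈-permsℕ⁻ (suc n) π∈))))) ⟩
  sumℚ (map (λ π → fromℕ (suc n) * weight θ (suc n) 0 π) (permsℕ (suc n)))
    ≡⟨ sumℚ-map-*ˡ (permsℕ (suc n)) (fromℕ (suc n)) _ ⟩
  fromℕ (suc n) * W′ θ (suc n) 0 ∎
  where open ≡-Reasoning

-- The closed form

factRatio≡ : ∀ N k → factRatio N k ≡ fromℕ ((N ∸ 1) !) * recip ((k ∸ 1) !)
factRatio≡ N k = /≡fromℕ*recip ((N ∸ 1) !) ((k ∸ 1) !) {{(k ∸ 1) !≢0}}

factRatio-sucˡ : ∀ n k → factRatio (suc (suc n)) k ≡ fromℕ (suc n) * factRatio (suc n) k
factRatio-sucˡ n k = begin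
  factRatio (suc (suc n)) k                 ≡⟨ factRatio≡ (suc (suc n)) k ⟩
  fromℕ (suc n ℕ.* n !) * r                 ≡⟨ cong (_* r) (fromℕ-* (suc n) (n !)) ⟩
  fromℕ (suc n) * fromℕ (n !) * r           ≡⟨ ℚP.*-assoc (fromℕ (suc n)) _ _ ⟩
  fromℕ (suc n) * (fromℕ (n !) * r)         ≡⟨ cong (fromℕ (suc n) *_) (sym (factRatio≡ (suc n) k)) ⟩
  fromℕ (suc n) * factRatio (suc n) k       ∎
  where
  open ≡-Reasoning
  r = recip ((k ∸ 1) !)

factRatio-sucʳ : ∀ N j → factRatio N (suc j) ≡ fromℕ (suc j) * factRatio N (suc (suc j))
factRatio-sucʳ N j = begin
  factRatio N (suc j)                       ≡⟨ factRatio≡ N (suc j) ⟩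
  f * recip (j !)                           ≡⟨ cong (f *_) (recip-*ˡ j (j !) {{j !≢0}}) ⟩
  f * (fromℕ (suc j) * recip (suc j !))
    ≡⟨ solve 3 (λ f a r → f :* (a :* r) := a :* (f :* r)) refl f (fromℕ (suc j)) (recip (suc j !)) ⟩
  fromℕ (suc j) * (f * recip (suc j !))     ≡⟨ cong (fromℕ (suc j) *_) (sym (factRatio≡ N (suc (suc j)))) ⟩
  fromℕ (suc j) * factRatio N (suc (suc j)) ∎
  where
  open ≡-Reasoning
  f = fromℕ ((N ∸ 1) !)

harmonic≡sumUpTo : ∀ k N → harmonic k N ≡ sumUpTo (N ∸ k) (λ j → recip (k ℕ.+ j))
harmonic≡sumUpTo k N = cong sumℚ (ListP.map-upTo (λ j → recip (k ℕ.+ j)) (N ∸ k))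

harmonic-sucʳ : ∀ k N → k ≤ N → harmonic k (suc N) ≡ harmonic k N + recip N
harmonic-sucʳ k N k≤N = begin
  harmonic k (suc N)                        ≡⟨ harmonic≡sumUpTo k (suc N) ⟩
  sumUpTo (suc N ∸ k) h                     ≡⟨ cong (λ n → sumUpTo n h) (ℕP.+-∸-assoc 1 k≤N) ⟩
  sumUpTo (suc (N ∸ k)) h                   ≡⟨ sumUpTo-suc (N ∸ k) h ⟩
  sumUpTo (N ∸ k) h + recip (k ℕ.+ (N ∸ k))
    ≡⟨ cong₂ _+_ (sym (harmonic≡sumUpTo k N)) (cong recip (ℕP.m+[n∸m]≡n k≤N)) ⟩
  harmonic k N + recip N                    ∎
  where
  open ≡-Reasoning
  h = λ j → recip (k ℕ.+ j)

harmonic-sucˡ : ∀ k N → k ℕ.< N → harmonic k N ≡ recip k + harmonic (suc k) N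
harmonic-sucˡ k N k<N = begin
  harmonic k N                              ≡⟨ harmonic≡sumUpTo k N ⟩
  sumUpTo (N ∸ k) h                         ≡⟨ cong (λ n → sumUpTo n h) (ℕP.+-∸-assoc 1 k<N) ⟩
  h 0 + sumUpTo (N ∸ suc k) (h ∘ suc)
    ≡⟨ cong₂ _+_ (cong recip (ℕP.+-identityʳ k)) (sumUpTo-cong (N ∸ suc k) (λ i → cong recip (ℕP.+-suc k i))) ⟩
  recip k + sumUpTo (N ∸ suc k) (λ j → recip (suc k ℕ.+ j))
    ≡⟨ cong (recip k +_) (sym (harmonic≡sumUpTo (suc k) N)) ⟩
  recip k + harmonic (suc k) N              ∎
  where
  open ≡-Reasoning
  h = λ j → recip (k ℕ.+ j)

harmonic-self : ∀ N → harmonic N N ≡ 0ℚ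
harmonic-self N =
  trans (harmonic≡sumUpTo N N) (cong (λ n → sumUpTo n (λ j → recip (N ℕ.+ j))) (ℕP.n∸n≡0 N))

closedForm : ℚ → ℕ → ℕ → ℚ
closedForm θ N zero    = fromℕ ((N ∸ 1) !) * θ
closedForm θ N (suc k) = θ * rising θ (suc k) * factRatio N (suc k) * harmonic (suc k) N

closedForm-diagonal : ∀ θ n → closedForm θ (suc n) (suc n) ≡ 0ℚ
closedForm-diagonal θ n =
  trans (cong (θ * rising θ (suc n) * factRatio (suc n) (suc n) *_) (harmonic-self (suc n)))
        (ℚP.*-zeroʳ (θ * rising θ (suc n) * factRatio (suc n) (suc n)))

closedForm-recurrence₀ : ∀ θ n → closedForm θ (suc (suc n)) 0 ≡ fromℕ (suc n) * closedForm θ (suc n) 0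
closedForm-recurrence₀ θ n = begin
  fromℕ (suc n ℕ.* n !) * θ         ≡⟨ cong (_* θ) (fromℕ-* (suc n) (n !)) ⟩
  fromℕ (suc n) * fromℕ (n !) * θ   ≡⟨ ℚP.*-assoc (fromℕ (suc n)) (fromℕ (n !)) θ ⟩
  fromℕ (suc n) * (fromℕ (n !) * θ) ∎
  where open ≡-Reasoning

-- The factors 1 = j · (1/j) and 1 = N · (1/N) are what turn the harmonic sums
-- for N and N + 1 into one another.
closedForm-recurrence : ∀ θ n j → j ℕ.< suc n →
  closedForm θ (suc (suc n)) (suc j)
  ≡ (θ + fromℕ j) * closedForm θ (suc n) j + fromℕ (suc n ∸ j) * closedForm θ (suc n) (suc j)
closedForm-recurrence θ n zero _ = begin
  θ * (1ℚ * (θ + 0ℚ)) * factRatio (suc (suc n)) 1 * harmonic 1 (suc (suc n))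
    ≡⟨ cong₂ (λ p q → θ * (1ℚ * (θ + 0ℚ)) * p * q)
             (factRatio-sucˡ n 1) (harmonic-sucʳ 1 (suc n) (s≤s z≤n)) ⟩
  θ * (1ℚ * (θ + 0ℚ)) * (c * f) * (H + v)
    ≡⟨ solve 5 (λ θ f c H v → θ :* (con 1ℚ :* (θ :+ con 0ℚ)) :* (c :* f) :* (H :+ v)
                 := θ :* θ :* f :* (c :* v) :+ θ :* θ :* f :* (c :* H)) refl θ f c H v ⟩
  θ * θ * f * (c * v) + θ * θ * f * (c * H)
    ≡⟨ cong (λ p → θ * θ * f * p + θ * θ * f * (c * H)) (fromℕ*recip (suc n)) ⟩
  θ * θ * f * 1ℚ + θ * θ * f * (c * H)
    ≡⟨ solve 4 (λ θ f c H → θ :* θ :* f :* con 1ℚ :+ θ :* θ :* f :* (c :* H)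
                 := (θ :+ con 0ℚ) :* (f :* θ) :+ c :* (θ :* (con 1ℚ :* (θ :+ con 0ℚ)) :* f :* H))
             refl θ f c H ⟩
  (θ + 0ℚ) * (f * θ) + c * (θ * (1ℚ * (θ + 0ℚ)) * f * H) ∎
  where
  open ≡-Reasoning
  f = fromℕ (n !)
  c = fromℕ (suc n)
  H = harmonic 1 (suc n)
  v = recip (suc n)
closedForm-recurrence θ n (suc j) j<N = begin
  θ * (R * (θ + a)) * factRatio (suc N) (suc (suc j)) * harmonic (suc (suc j)) (suc N)
    ≡⟨ cong₂ (λ p q → θ * (R * (θ + a)) * p * q)
             (factRatio-sucˡ n (suc (suc j))) (harmonic-sucʳ (suc (suc j)) N j<N) ⟩
  θ * (R * (θ + a)) * (c * F) * (H + v)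
    ≡⟨ solve 7 (λ θ R a F H v c → θ :* (R :* (θ :+ a)) :* (c :* F) :* (H :+ v)
                 := θ :* (R :* (θ :+ a)) :* F :* (c :* v) :+ θ :* (R :* (θ :+ a)) :* F :* (c :* H))
             refl θ R a F H v c ⟩
  X * (c * v) + X * (c * H)
    ≡⟨ cong (λ p → X * p + X * (c * H)) (trans (fromℕ*recip N) (sym (fromℕ*recip (suc j)))) ⟩
  X * (a * u) + X * (c * H)
    ≡⟨ cong (λ p → X * (a * u) + X * (p * H)) (sym a+b≡c) ⟩
  X * (a * u) + X * ((a + b) * H)
    ≡⟨ solve 7 (λ θ R a b F H u →
                   θ :* (R :* (θ :+ a)) :* F :* (a :* u) :+ θ :* (R :* (θ :+ a)) :* F :* ((a :+ b) :* H)
                 := (θ :+ a) :* (θ :* R :* (a :* F) :* (u :+ H)) :+ b :* (θ :* (R :* (θ :+ a)) :* F :* H))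
             refl θ R a b F H u ⟩
  (θ + a) * (θ * R * (a * F) * (u + H)) + b * (θ * (R * (θ + a)) * F * H)
    ≡⟨ sym (cong₂ (λ p q → (θ + a) * (θ * R * p * q) + b * (θ * (R * (θ + a)) * F * H))
                  (factRatio-sucʳ N j) (harmonic-sucˡ (suc j) N j<N)) ⟩
  (θ + a) * closedForm θ N (suc j) + b * closedForm θ N (suc (suc j)) ∎
  where
  open ≡-Reasoning
  N = suc n
  a = fromℕ (suc j)
  b = fromℕ (N ∸ suc j)
  c = fromℕ N
  R = rising θ (suc j)
  F = factRatio N (suc (suc j))
  H = harmonic (suc (suc j)) N
  u = recip (suc j)
  v = recip N
  X = θ * (R * (θ + a)) * F
  a+b≡c : a + b ≡ c
  a+b≡c = trans (sym (fromℕ-+ (suc j) (N ∸ suc j))) (cong fromℕ (ℕP.m+[n∸m]≡n (ℕP.<⇒≤ j<N)))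

W′≡closedForm : ∀ θ n k → k ≤ suc n → W′ θ (suc n) k ≡ closedForm θ (suc n) k
W′≡closedForm θ zero    zero          _ = solve 1 (λ θ → θ :* con 1ℚ :+ con 0ℚ := con 1ℚ :* θ) refl θ
W′≡closedForm θ zero    (suc zero)    _ = sym (closedForm-diagonal θ 0)
W′≡closedForm θ zero    (suc (suc k)) (s≤s ())
W′≡closedForm θ (suc n) zero          _ = begin
  W′ θ (suc (suc n)) 0                 ≡⟨ W′-recurrence₀ θ n ⟩
  fromℕ (suc n) * W′ θ (suc n) 0       ≡⟨ cong (fromℕ (suc n) *_) (W′≡closedForm θ n 0 z≤n) ⟩
  fromℕ (suc n) * closedForm θ (suc n) 0 ≡⟨ sym (closedForm-recurrence₀ θ n) ⟩
  closedForm θ (suc (suc n)) 0         ∎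
  where open ≡-Reasoning
W′≡closedForm θ (suc n) (suc j) (s≤s j≤) with ℕP.m≤n⇒m<n∨m≡n j≤
... | inj₁ j<1+n = begin
  W′ θ (suc (suc n)) (suc j)
    ≡⟨ W′-recurrence θ n j j≤ ⟩
  (θ + fromℕ j) * W′ θ (suc n) j + fromℕ (suc n ∸ j) * W′ θ (suc n) (suc j)
    ≡⟨ cong₂ (λ p q → (θ + fromℕ j) * p + fromℕ (suc n ∸ j) * q)
             (W′≡closedForm θ n j j≤) (W′≡closedForm θ n (suc j) j<1+n) ⟩
  (θ + fromℕ j) * closedForm θ (suc n) j + fromℕ (suc n ∸ j) * closedForm θ (suc n) (suc j)
    ≡⟨ sym (closedForm-recurrence θ n j j<1+n) ⟩
  closedForm θ (suc (suc n)) (suc j) ∎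
  where open ≡-Reasoning
-- Here the coefficient of W′ θ (suc n) (suc (suc n)) vanishes, which is outside the induction.
... | inj₂ refl = begin
  W′ θ (suc (suc n)) (suc (suc n))
    ≡⟨ W′-recurrence θ n (suc n) j≤ ⟩
  (θ + fromℕ (suc n)) * W′ θ (suc n) (suc n) + fromℕ (suc n ∸ suc n) * Y
    ≡⟨ cong₂ (λ p q → (θ + fromℕ (suc n)) * p + fromℕ q * Y)
             (trans (W′≡closedForm θ n (suc n) j≤) (closedForm-diagonal θ n)) (ℕP.n∸n≡0 n) ⟩
  (θ + fromℕ (suc n)) * 0ℚ + 0ℚ * Y
    ≡⟨ solve 2 (λ t Y → t :* con 0ℚ :+ con 0ℚ :* Y := con 0ℚ) refl (θ + fromℕ (suc n)) Y ⟩
  0ℚ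
    ≡⟨ sym (closedForm-diagonal θ (suc n)) ⟩
  closedForm θ (suc (suc n)) (suc (suc n)) ∎
  where
  open ≡-Reasoning
  Y = W′ θ (suc n) (suc (suc n))

theorem5p1 : (θ : ℚ) → 0ℚ < θ → (N : ℕ) → 1 ≤ N →
    ((k : ℕ) → 1 ≤ k → k ≤ N ∸ 1 →
      W θ N k ≡ θ * rising θ k * factRatio N k * harmonic k N)
    × (W θ N 0 ≡ fromℕ ((N ∸ 1) !) * θ)
theorem5p1 θ _ (suc n) _ = winnable , trans (W≡W′ θ (suc n) 0) (W′≡closedForm θ n 0 z≤n)
  where
  winnable : (k : ℕ) → 1 ≤ k → k ≤ n →
    W θ (suc n) k ≡ θ * rising θ k * factRatio (suc n) k * harmonic k (suc n)
  winnable (suc k) _ k<n =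
    trans (W≡W′ θ (suc n) (suc k)) (W′≡closedForm θ n (suc k) (ℕP.m≤n⇒m≤1+n k<n))
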